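{- Let $Q$ be a finite connected poset, let $e\in Q$ be neither minimal nor maximal in $Q$, let $Q'=Q\setminus\{e\}$, $D=\{x\in Q: x<e\}$ and $U=\{x\in Q: x>e\}$, and let $X\subseteq\max(Q)$ and $Y\subseteq\min(Q)$ be such that $\{e\}$, $X$, $Y$ are pairwise parallel. Then \[ \alpha(Q,X,Y)=\alpha(Q',X,Y)+\alpha(Q'/U/D,X,Y). \]
   Context: A subset of a poset is connected if it is non-empty and any two of its elements are joined by a sequence of its elements with consecutive elements comparable. $A\parallel B$ means every element of $A$ is incomparable to every element of $B$. For a poset $R$, $X\subseteq\max(R)$, $Y\subseteq\min(R)$: an antichain $B\subseteq R$ is biconnected in $R$ if $B\,\Delta\,\min(R)$ and $B\,\Delta\,\max(R)$ are both connected; it is an $(X,Y)$-antichain in $R$ if $B\cap\max(R)=X$ and $B\cap\min(R)=Y$; $\alpha(R,X,Y)$ is the number of biconnected $(X,Y)$-antichains in $R$. Contraction: for a filter or order ideal $J$ of a poset $P$, $P/J$ is the poset whose elements are the classes $\{x\}$ for $x\in P\setminus J$ together with the class $J$ (if $J\neq\emptyset$), with $[x]\le[y]$ iff $x'\le y'$ for some $x'\in[x]$, $y'\in[y]$; elements outside $J$ are identified with their singleton classes. Here $U$ is a filter of $Q'$, $D$ is an order ideal of $Q'$ and of $Q'/U$, and $Q'/U/D=(Q'/U)/D$. Since $X$ and $Y$ are disjoint from $U\cup D$, they are regarded as sets of maximal, respectively minimal, elements of $Q'$ and of its contractions. -}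

module Defs where

open import Data.Nat using (ℕ)
open import Data.Fin using (Fin; _≟_)
open import Data.Bool using (Bool; true; false; not; T)
open import Data.Product using (Σ; ∃; ∃₂; _×_; _,_; proj₁)
open import Data.Sum using (_⊎_)
open import Data.Unit using (⊤)
open import Relation.Nullary using (¬_; Dec; does)
open import Relation.Nullary.Decidable using (_×-dec_; ¬?)
open import Relation.Binary using (Decidable; IsPartialOrder; Setoid)
open import Relation.Binary.PropositionalEquality using (_≡_; _≢_; setoid)
open import Function.Bundles using (Inverse)

-- All notions
-- below (maximal, antichain, connected, ...) only refer to the relation,
-- so they apply verbatim to posets and to their contractions.

record RelStr : Set₁ where
  field
    Carrier : Set
    _≤_     : Carrier → Carrier → Set

module _ (R : RelStr) where
  open RelStr R

  Comparable : Carrier → Carrier → Set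
  Comparable x y = x ≤ y ⊎ y ≤ x

  IsMax : Carrier → Set
  IsMax x = ∀ y → x ≤ y → x ≡ y

  IsMin : Carrier → Set
  IsMin x = ∀ y → y ≤ x → x ≡ y

  data Chain (S : Carrier → Set) : Carrier → Carrier → Set where
    done : ∀ {x} → Chain S x x
    step : ∀ {x z y} → Comparable x z → S z → Chain S z y → Chain S x y

  Connected : (Carrier → Set) → Set
  Connected S = Σ Carrier S × (∀ x y → S x → S y → Chain S x y)

  Parallel : (Carrier → Set) → (Carrier → Set) → Set
  Parallel A B = ∀ x y → A x → B y → ¬ Comparable x y

  Antichain : (Carrier → Bool) → Set
  Antichain B = ∀ x y → T (B x) → T (B y) → x ≤ y → x ≡ y

  _Δ_ : (Carrier → Set) → (Carrier → Set) → (Carrier → Set)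
  (A Δ C) x = (A x × ¬ C x) ⊎ (¬ A x × C x)

  Biconnected : (Carrier → Bool) → Set
  Biconnected B = Antichain B
                × Connected ((λ x → T (B x)) Δ IsMin)
                × Connected ((λ x → T (B x)) Δ IsMax)

  IsXYAntichain : (X Y : Carrier → Bool) → (Carrier → Bool) → Set
  IsXYAntichain X Y B =
      Antichain B
    × (∀ x → ((T (B x) × IsMax x) → T (X x)) × (T (X x) → (T (B x) × IsMax x)))
    × (∀ x → ((T (B x) × IsMin x) → T (Y x)) × (T (Y x) → (T (B x) × IsMin x)))

  BiconnSetoid : (X Y : Carrier → Bool) → Setoid _ _
  BiconnSetoid X Y = record
    { Carrier = Σ (Carrier → Bool) (λ B → Biconnected B × IsXYAntichain X Y B)
    ; _≈_ = λ B C → ∀ x → proj₁ B x ≡ proj₁ C x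
    ; isEquivalence = record
      { refl = λ x → Relation.Binary.PropositionalEquality.refl
      ; sym = λ p x → Relation.Binary.PropositionalEquality.sym (p x)
      ; trans = λ p q x → Relation.Binary.PropositionalEquality.trans (p x) (q x) } }

  -- α(R,X,Y) = k : the biconnected (X,Y)-antichains are in bijection with Fin k
  AlphaIs : (X Y : Carrier → Bool) → ℕ → Set
  AlphaIs X Y k = Inverse (setoid (Fin k)) (BiconnSetoid X Y)

-- Contraction R/J by a (decidable) subset J, intended to be a filter or
-- order ideal.  Classes: {x} for x ∉ J, and the class J if J ≠ ∅.

data Cls {C : Set} (J : C → Bool) : Set where
  blob : .(Σ C (λ x → T (J x))) → Cls J
  elt  : (x : C) → .(T (not (J x))) → Cls J

module _ {C : Set} {J : C → Bool} where
  InCls : C → Cls J → Set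
  InCls a (blob _)  = T (J a)
  InCls a (elt x _) = a ≡ x

  -- transport of a subset disjoint from J to the contraction
  liftSub : (C → Bool) → Cls J → Bool
  liftSub P (blob _)  = false
  liftSub P (elt x _) = P x

_/_ : (R : RelStr) → (RelStr.Carrier R → Bool) → RelStr
R / J = record
  { Carrier = Cls J
  ; _≤_ = λ c d → ∃₂ λ a b → InCls a c × InCls b d × RelStr._≤_ R a b }

record FinPoset : Set₁ where
  field
    size           : ℕ
    _≤_            : Fin size → Fin size → Set
    isPartialOrder : IsPartialOrder _≡_ _≤_
    _≤?_           : Decidable _≤_

module _ (P : FinPoset) where
  open FinPoset P

  _<_ : Fin size → Fin size → Set
  x < y = x ≤ y × x ≢ y

  _<?_ : Decidable _<_
  x <? y = (x ≤? y) ×-dec ¬? (x ≟ y)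

  asRel : RelStr
  asRel = record { Carrier = Fin size ; _≤_ = _≤_ }

  Q′ : Fin size → RelStr
  Q′ e = record
    { Carrier = Σ (Fin size) (λ x → T (not (does (x ≟ e))))
    ; _≤_ = λ a b → proj₁ a ≤ proj₁ b }

  Uset : (e : Fin size) → RelStr.Carrier (Q′ e) → Bool
  Uset e a = does (e <? proj₁ a)

  Q′/U : Fin size → RelStr
  Q′/U e = Q′ e / Uset e

  Dset : (e : Fin size) → RelStr.Carrier (Q′/U e) → Bool
  Dset e (blob _)  = false
  Dset e (elt a _) = does (proj₁ a <? e)

  Q′/U/D : Fin size → RelStr
  Q′/U/D e = Q′/U e / Dset e

  toQ′ : (e : Fin size) → (Fin size → Bool) → RelStr.Carrier (Q′ e) → Bool
  toQ′ e X a = X (proj₁ a)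

  toQ′/U/D : (e : Fin size) → (Fin size → Bool) → RelStr.Carrier (Q′/U/D e) → Bool
  toQ′/U/D e X = liftSub (liftSub (toQ′ e X))

{-# OPTIONS --safe #-}
module Submission where

-- A biconnected (X,Y)-antichain B of Q either avoids e or contains it.
--
-- If e ∉ B, then B is a biconnected (X,Y)-antichain of Q′ = Q ∖ {e}: since e lies strictly between
-- two elements, deleting it changes no minimality or maximality, and e ∉ B Δ min Q, B Δ max Q.
--
-- If e ∈ B, then B meets neither D nor U, and B ∖ {e} is a biconnected (X,Y)-antichain of Q′/U/D.
-- On the minimal side the collapsing map Q → Q′/U/D sends e and D to the minimal class D, and U is
-- disjoint from B Δ min Q, so B Δ min Q maps onto B Δ min (Q′/U/D); connectivity transfers in both
-- directions because every element comparable with the class D lies above some d < e, and a minimal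
-- element below d links it to e inside B Δ min Q.  The maximal side is the same argument for the
-- dual order.
--
-- Both families are families of subsets of the finite set Q cut out by decidable conditions
-- (connectivity is decided by Floyd–Warshall), so they have sizes b and c, and α(Q) = b + c.

open import Defs
open import Data.Nat using (ℕ; _+_)
open import Data.Fin using (Fin)
open import Data.Bool using (Bool; T)
open import Data.Product using (Σ; _×_)
open import Data.Unit using (⊤)
open import Relation.Nullary using (¬_)
open import Relation.Binary.PropositionalEquality using (_≡_)

import Data.Bool as Bool
open import Data.Bool using (true; false; not)
open import Data.Bool.Properties using (T-irrelevant; T-≡; ¬-not)
import Data.Empty.Irrelevant as Irrelevant
open import Data.Fin using (zero; suc; toℕ; fromℕ<; _≟_)
open import Data.Fin.Induction using (po-wellFounded)
open import Data.Fin.Properties using (all?; any?; toℕ<n; toℕ-injective; toℕ-fromℕ<; +↔⊎)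
open import Data.Nat as ℕ using (zero; suc)
import Data.Nat.Properties as ℕ
open import Data.Product using (∃; ∃₂; _,_; proj₁; proj₂)
open import Data.Sum using (_⊎_; inj₁; inj₂; [_,_]; swap)
open import Data.Sum.Function.Setoid using (_⊎-inverse_)
open import Data.Sum.Relation.Binary.Pointwise using (_⊎ₛ_; inj₁; inj₂; Pointwise-≡↔≡)
open import Data.Unit using (tt)
open import Data.Vec.Functional using (_∷_; tail)
open import Function using (_∘_; flip; _⇔_; mk⇔; Equivalence; Inverse)
import Function.Consequences.Setoid as Consequences
import Function.Construct.Composition as Composition
open import Function.Construct.Identity using (⇔-id)
import Function.Construct.Symmetry as Symmetry
open import Function.Construct.Symmetry using (⇔-sym)
open import Induction.WellFounded using (Acc; acc)
open import Level using (0ℓ)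
open import Relation.Binary using (Rel; Setoid; IsPartialOrder; _Respects_) renaming (Decidable to Decidable₂)
open import Relation.Binary.Construct.Closure.ReflexiveTransitive using (Star; ε; _◅_; _◅◅_)
import Relation.Binary.Construct.Flip.EqAndOrd as Flip
import Relation.Binary.Construct.NonStrictToStrict as ToStrict
open import Relation.Binary.PropositionalEquality using (_≢_; refl; sym; trans; cong; subst; subst₂; setoid; _≗_; ≢-sym)
open import Relation.Nullary using (Dec; yes; no; does; contradiction)
open import Relation.Nullary.Decidable as Dec using (_×-dec_; _⊎-dec_; _→-dec_; ¬?; T?; recompute)
open import Relation.Unary as U using (Pred; _⊆_; _≐_)

open Equivalence using (to; from)

module _ {A : Set} where

  does⁺ : (a? : Dec A) → A → T (does a?)
  does⁺ (yes _) _ = tt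
  does⁺ (no ¬a) a = ¬a a

  does⁻ : (a? : Dec A) → T (does a?) → A
  does⁻ (yes a) _ = a

  not-does⁺ : (a? : Dec A) → ¬ A → T (not (does a?))
  not-does⁺ (yes a) ¬a = ¬a a
  not-does⁺ (no _) _ = tt

  not-does⁻ : (a? : Dec A) → T (not (does a?)) → ¬ A
  not-does⁻ (no ¬a) _ = ¬a

T-⇔ : ∀ {b b′} → b ≡ b′ → T b ⇔ T b′
T-⇔ refl = ⇔-id _

¬T⇒≡false : ∀ {b} → ¬ T b → b ≡ false
¬T⇒≡false ¬t = ¬-not (¬t ∘ from T-≡)

-- Finite families of subsets

mkSetoidInverse : {S T : Setoid 0ℓ 0ℓ} (f : Setoid.Carrier S → Setoid.Carrier T) (g : Setoid.Carrier T → Setoid.Carrier S) →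
  (∀ {x y} → Setoid._≈_ S x y → Setoid._≈_ T (f x) (f y)) →
  (∀ {x y} → Setoid._≈_ T x y → Setoid._≈_ S (g x) (g y)) →
  (∀ y → Setoid._≈_ T (f (g y)) y) → (∀ x → Setoid._≈_ S (g (f x)) x) → Inverse S T
mkSetoidInverse {S} {T} f g f-cong g-cong f∘g g∘f = record
  { to = f ; from = g ; to-cong = f-cong ; from-cong = g-cong
  ; inverse = strictlyInverseˡ⇒inverseˡ f-cong f∘g , strictlyInverseʳ⇒inverseʳ g-cong g∘f }
  where open Consequences S T

-- `BiconnSetoid R X Y` is definitionally `Subsets (Carrier R) (BiconnectedXY X Y)`.
Subsets : (C : Set) → ((C → Bool) → Set) → Setoid 0ℓ 0ℓ
Subsets C P = record
  { Carrier = Σ (C → Bool) P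
  ; _≈_ = λ B C → ∀ x → proj₁ B x ≡ proj₁ C x
  ; isEquivalence = record
    { refl = λ x → refl
    ; sym = λ p x → sym (p x)
    ; trans = λ p q x → trans (p x) (q x) } }

Pinned : {C : Set} → ((C → Bool) → Set) → C → Bool → (C → Bool) → Set
Pinned P c b B = B c ≡ b × P B

Pinned-resp : ∀ {C : Set} {P : (C → Bool) → Set} {c b} → P Respects _≗_ → Pinned P c b Respects _≗_
Pinned-resp resp B≗B′ (Bc≡b , p) = trans (sym (B≗B′ _)) Bc≡b , resp B≗B′ p

Subsets-split : {C : Set} (P : (C → Bool) → Set) (c : C) →
  Inverse (Subsets C P) (Subsets C (Pinned P c false) ⊎ₛ Subsets C (Pinned P c true))
Subsets-split {C} P c = mkSetoidInverse (λ (B , p) → sort B p (B c) refl) forget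
  (λ B≗B′ → sort-cong B≗B′ _ _ refl refl)
  (λ { (inj₁ B≗B′) → B≗B′ ; (inj₂ B≗B′) → B≗B′ })
  sort-forget
  (λ (B , p) → forget-sort B p (B c) refl)
  where
  Parts = Subsets C (Pinned P c false) ⊎ₛ Subsets C (Pinned P c true)
  sort : ∀ B → P B → ∀ b → B c ≡ b → Setoid.Carrier Parts
  sort B p false Bc≡b = inj₁ (B , Bc≡b , p)
  sort B p true Bc≡b = inj₂ (B , Bc≡b , p)
  forget : Setoid.Carrier Parts → Setoid.Carrier (Subsets C P)
  forget (inj₁ (B , _ , p)) = B , p
  forget (inj₂ (B , _ , p)) = B , p
  sort-cong : ∀ {B B′ p p′} → (∀ x → B x ≡ B′ x) → ∀ b b′ (eq : B c ≡ b) (eq′ : B′ c ≡ b′) →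
    Setoid._≈_ Parts (sort B p b eq) (sort B′ p′ b′ eq′)
  sort-cong B≗B′ false false eq eq′ = inj₁ B≗B′
  sort-cong B≗B′ true true eq eq′ = inj₂ B≗B′
  sort-cong B≗B′ false true eq eq′ with () ← trans (sym eq) (trans (B≗B′ c) eq′)
  sort-cong B≗B′ true false eq eq′ with () ← trans (sym eq) (trans (B≗B′ c) eq′)
  sort-forget : ∀ y → Setoid._≈_ Parts (sort _ _ (proj₁ (forget y) c) refl) y
  sort-forget (inj₁ (B , eq , p)) = sort-cong (λ _ → refl) (B c) false refl eq
  sort-forget (inj₂ (B , eq , p)) = sort-cong (λ _ → refl) (B c) true refl eq
  forget-sort : ∀ B p b (eq : B c ≡ b) x → proj₁ (forget (sort B p b eq)) x ≡ B x
  forget-sort B p false eq x = refl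
  forget-sort B p true eq x = refl

Subsets-cons : ∀ {n} (P : (Fin (suc n) → Bool) → Set) → P Respects _≗_ → ∀ b →
  Inverse (Subsets (Fin (suc n)) (Pinned P zero b)) (Subsets (Fin n) (λ B → P (b ∷ B)))
Subsets-cons P resp b = mkSetoidInverse
  (λ (B , B0≡b , p) → tail B , resp (cons-tail B0≡b) p)
  (λ (B , p) → (b ∷ B) , refl , p)
  (λ B≗B′ i → B≗B′ (suc i))
  (λ { B≗B′ zero → refl ; B≗B′ (suc i) → B≗B′ i })
  (λ _ _ → refl)
  (λ (B , B0≡b , _) x → sym (cons-tail {B} B0≡b x))
  where
  cons-tail : ∀ {B} → B zero ≡ b → B ≗ (b ∷ tail B)
  cons-tail B0≡b zero = B0≡b
  cons-tail B0≡b (suc i) = refl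

Fin-+ : ∀ a b → Inverse (setoid (Fin (a + b))) (setoid (Fin a) ⊎ₛ setoid (Fin b))
Fin-+ a b = Composition.inverse +↔⊎ (Symmetry.inverse (Pointwise-≡↔≡ (Fin a) (Fin b)))

subsets-finite : ∀ n (P : (Fin n → Bool) → Set) → U.Decidable P → P Respects _≗_ →
  Σ ℕ λ k → Inverse (setoid (Fin k)) (Subsets (Fin n) P)
subsets-finite zero P P? resp with P? (λ ())
... | yes p = 1 , mkSetoidInverse (λ _ → (λ ()) , p) (λ _ → zero) (λ _ ()) (λ _ → refl) (λ _ ()) (λ { zero → refl })
... | no ¬p = 0 , mkSetoidInverse (λ ()) (λ (_ , p) → contradiction (resp (λ ()) p) ¬p) (λ { {()} })
                    (λ { {_ , p} → contradiction (resp (λ ()) p) ¬p }) (λ (_ , p) → contradiction (resp (λ ()) p) ¬p) (λ ())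
subsets-finite (suc n) P P? resp =
  let a , Fa = subsets-finite n (λ B → P (false ∷ B)) (λ B → P? (false ∷ B)) (λ eq → resp (cons-cong false eq))
      b , Fb = subsets-finite n (λ B → P (true ∷ B)) (λ B → P? (true ∷ B)) (λ eq → resp (cons-cong true eq))
  in a + b , Composition.inverse (Fin-+ a b) (Composition.inverse (Fa ⊎-inverse Fb)
               (Symmetry.inverse (Composition.inverse (Subsets-split P zero)
                 (Subsets-cons P resp false ⊎-inverse Subsets-cons P resp true))))
  where
  cons-cong : ∀ b {B B′ : Fin n → Bool} → B ≗ B′ → (b ∷ B) ≗ (b ∷ B′)
  cons-cong b B≗B′ zero = refl
  cons-cong b B≗B′ (suc i) = B≗B′ i

-- Chains and connectedness

-- A pointwise clause of `IsXYAntichain`.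
Agreement : Set → Set → Set → Set
Agreement A C M = ((A × M) → C) × (C → A × M)

Agreement-cong : ∀ {A A′ C C′ M M′} → A ⇔ A′ → C ⇔ C′ → M ⇔ M′ → Agreement A C M → Agreement A′ C′ M′
Agreement-cong A⇔A′ C⇔C′ M⇔M′ (am⇒c , c⇒am) =
  (λ (a , m) → to C⇔C′ (am⇒c (from A⇔A′ a , from M⇔M′ m))) ,
  λ c → let a , m = c⇒am (from C⇔C′ c) in to A⇔A′ a , to M⇔M′ m

Agreement-absent : ∀ {A C M} → ¬ C → ¬ (A × M) → Agreement A C M
Agreement-absent ¬c ¬am = (λ am → contradiction am ¬am) , λ c → contradiction c ¬c

Δ-⇔ : ∀ {A M A′ M′ : Set} → A ⇔ A′ → M ⇔ M′ → ((A × ¬ M) ⊎ (¬ A × M)) ⇔ ((A′ × ¬ M′) ⊎ (¬ A′ × M′))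
Δ-⇔ A⇔A′ M⇔M′ = mk⇔
  [ (λ (a , ¬m) → inj₁ (to A⇔A′ a , ¬m ∘ from M⇔M′)) , (λ (¬a , m) → inj₂ (¬a ∘ from A⇔A′ , to M⇔M′ m)) ]
  [ (λ (a , ¬m) → inj₁ (from A⇔A′ a , ¬m ∘ to M⇔M′)) , (λ (¬a , m) → inj₂ (¬a ∘ to A⇔A′ , from M⇔M′ m)) ]

module _ {R : RelStr} where
  open RelStr R

  infixr 5 _++ᶜ_
  _++ᶜ_ : ∀ {S x y z} → Chain R S x y → Chain R S y z → Chain R S x z
  done ++ᶜ q = q
  step c s p ++ᶜ q = step c s (p ++ᶜ q)

  Chain-reverse : ∀ {S x y} → S x → Chain R S x y → Chain R S y x
  Chain-reverse sx done = done
  Chain-reverse sx (step c sz p) = Chain-reverse sz p ++ᶜ step (swap c) sx done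

  Chain-mono : ∀ {S S′ : Pred Carrier _} → S ⊆ S′ → ∀ {x y} → Chain R S x y → Chain R S′ x y
  Chain-mono S⊆S′ done = done
  Chain-mono S⊆S′ (step c s p) = step c (S⊆S′ s) (Chain-mono S⊆S′ p)

  Connected-≐ : ∀ {S S′ : Pred Carrier _} → S ≐ S′ → Connected R S → Connected R S′
  Connected-≐ (S⊆S′ , S′⊆S) ((x , s) , chain) =
    (x , S⊆S′ s) , λ x y s s′ → Chain-mono S⊆S′ (chain x y (S′⊆S s) (S′⊆S s′))

  BiconnectedXY : (X Y : Carrier → Bool) → (Carrier → Bool) → Set
  BiconnectedXY X Y B = Biconnected R B × IsXYAntichain R X Y B

  BiconnectedXY-resp : ∀ X Y → BiconnectedXY X Y Respects _≗_
  BiconnectedXY-resp X Y {B} {B′} B≗B′ ((anti , cmin , cmax) , _ , xs , ys) =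
    (anti′ , Connected-≐ (Δ-≐ (IsMin R)) cmin , Connected-≐ (Δ-≐ (IsMax R)) cmax) , anti′ ,
    (λ x → Agreement-cong (T-⇔ (B≗B′ x)) (⇔-id _) (⇔-id _) (xs x)) ,
    (λ x → Agreement-cong (T-⇔ (B≗B′ x)) (⇔-id _) (⇔-id _) (ys x))
    where
    anti′ : Antichain R B′
    anti′ x y b b′ = anti x y (from (T-⇔ (B≗B′ x)) b) (from (T-⇔ (B≗B′ y)) b′)
    Δ-≐ : (M : Carrier → Set) → _Δ_ R (T ∘ B) M ≐ _Δ_ R (T ∘ B′) M
    Δ-≐ M = (λ {x} → to (Δ-⇔ (T-⇔ (B≗B′ x)) (⇔-id _))) , (λ {x} → from (Δ-⇔ (T-⇔ (B≗B′ x)) (⇔-id _)))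

_ᵒᵖ : RelStr → RelStr
R ᵒᵖ = record { Carrier = RelStr.Carrier R ; _≤_ = flip (RelStr._≤_ R) }

module _ {R : RelStr} {S : Pred (RelStr.Carrier R) 0ℓ} where

  Chain-ᵒᵖ : ∀ {x y} → Chain (R ᵒᵖ) S x y → Chain R S x y
  Chain-ᵒᵖ done = done
  Chain-ᵒᵖ (step c s p) = step (swap c) s (Chain-ᵒᵖ p)

  Connected-ᵒᵖ : Connected (R ᵒᵖ) S → Connected R S
  Connected-ᵒᵖ (s , chain) = s , λ x y sx sy → Chain-ᵒᵖ (chain x y sx sy)

Connected-ᵒᵖ⇔ : ∀ {R S} → Connected (R ᵒᵖ) S ⇔ Connected R S
Connected-ᵒᵖ⇔ {R} = mk⇔ Connected-ᵒᵖ (Connected-ᵒᵖ {R ᵒᵖ})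

module _ {R₁ R₂ : RelStr} (f : RelStr.Carrier R₁ → RelStr.Carrier R₂)
         {S₁ : Pred (RelStr.Carrier R₁) 0ℓ} {S₂ : Pred (RelStr.Carrier R₂) 0ℓ}
         (f-into : ∀ {x} → S₁ x → S₂ (f x))
         (f-onto : ∀ {y} → S₂ y → ∃ λ x → S₁ x × f x ≡ y) where

  Connected-image : (∀ {x y} → S₁ x → S₁ y → Comparable R₁ x y → Comparable R₂ (f x) (f y) ⊎ f x ≡ f y) →
                    Connected R₁ S₁ → Connected R₂ S₂
  Connected-image f-comparable ((x , s) , chain) = (f x , f-into s) , λ y y′ sy sy′ → chain-onto (f-onto sy) (f-onto sy′)
    where
    map-chain : ∀ {x y} → S₁ x → Chain R₁ S₁ x y → Chain R₂ S₂ (f x) (f y)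
    map-chain sx done = done
    map-chain sx (step c sz p) with f-comparable sx sz c
    ... | inj₁ c′ = step c′ (f-into sz) (map-chain sz p)
    ... | inj₂ fx≡fz rewrite fx≡fz = map-chain sz p
    chain-onto : ∀ {y y′} → ∃ (λ x → S₁ x × f x ≡ y) → ∃ (λ x → S₁ x × f x ≡ y′) → Chain R₂ S₂ y y′
    chain-onto (x₁ , s₁ , refl) (x₂ , s₂ , refl) = map-chain s₁ (chain x₁ x₂ s₁ s₂)

  Connected-preimage : (∀ {x y′} → S₁ x → Comparable R₂ (f x) y′ → S₂ y′ → ∃ λ y → S₁ y × f y ≡ y′ × Chain R₁ S₁ x y) →
                       (∀ {x y} → S₁ x → S₁ y → f x ≡ f y → Chain R₁ S₁ x y) →
                       Connected R₂ S₂ → Connected R₁ S₁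
  Connected-preimage lift-step fibre-chain ((y , s) , chain) =
    (proj₁ (f-onto s) , proj₁ (proj₂ (f-onto s))) , λ x x′ sx sx′ →
      let z , sz , fz≡fx′ , x⇝z = lift-chain (chain (f x) (f x′) (f-into sx) (f-into sx′)) sx refl
      in x⇝z ++ᶜ fibre-chain sz sx′ fz≡fx′
    where
    lift-chain : ∀ {x′ y′} → Chain R₂ S₂ x′ y′ → ∀ {x} → S₁ x → f x ≡ x′ →
                 ∃ λ y → S₁ y × f y ≡ y′ × Chain R₁ S₁ x y
    lift-chain done sx fx≡x′ = _ , sx , fx≡x′ , done
    lift-chain (step c s p) sx refl =
      let z , sz , fz≡ , x⇝z = lift-step sx c s
          y , sy , fy≡ , z⇝y = lift-chain p sz fz≡
      in y , sy , fy≡ , x⇝z ++ᶜ z⇝y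

-- Deciding biconnectedness on a finite poset

module Reachability {n : ℕ} {_~_ : Rel (Fin n) 0ℓ} (_~?_ : Decidable₂ _~_) where

  -- Floyd–Warshall: paths all of whose intermediate vertices have index below k.
  data Path (k : ℕ) : Fin n → Fin n → Set where
    edge : ∀ {x y} → x ≡ y ⊎ x ~ y → Path k x y
    via  : ∀ {x y} z → toℕ z ℕ.< k → Path k x z → Path k z y → Path k x y

  Path-sound : ∀ {k x y} → Path k x y → Star _~_ x y
  Path-sound (edge (inj₁ refl)) = ε
  Path-sound (edge (inj₂ x~y)) = x~y ◅ ε
  Path-sound (via z _ p q) = Path-sound p ◅◅ Path-sound q

  Path-complete : ∀ {x y} → Star _~_ x y → Path n x y
  Path-complete ε = edge (inj₁ refl)
  Path-complete (_◅_ {j = z} x~z p) = via z (toℕ<n z) (edge (inj₂ x~z)) (Path-complete p)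

  Path-suc : ∀ {k x y} → Path k x y → Path (suc k) x y
  Path-suc (edge e) = edge e
  Path-suc (via z z<k p q) = via z (ℕ.m<n⇒m<1+n z<k) (Path-suc p) (Path-suc q)

  Path-split : ∀ {k x y} (k<n : k ℕ.< n) → Path (suc k) x y →
               Path k x y ⊎ (Path k x (fromℕ< k<n) × Path k (fromℕ< k<n) y)
  Path-split k<n (edge e) = inj₁ (edge e)
  Path-split {k} k<n (via z z<1+k p q) with ℕ.m<1+n⇒m<n∨m≡n z<1+k | Path-split k<n p | Path-split k<n q
  ... | inj₁ z<k | inj₁ p′ | inj₁ q′ = inj₁ (via z z<k p′ q′)
  ... | inj₁ z<k | inj₁ p′ | inj₂ (q₁ , q₂) = inj₂ (via z z<k p′ q₁ , q₂)
  ... | inj₁ z<k | inj₂ (p₁ , p₂) | inj₁ q′ = inj₂ (p₁ , via z z<k p₂ q′)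
  ... | inj₁ _ | inj₂ (p₁ , _) | inj₂ (_ , q₂) = inj₂ (p₁ , q₂)
  ... | inj₂ z≡k | p′ | q′ = inj₂ (into-k p′ , out-of-k q′)
    where
    z≡k′ : z ≡ fromℕ< k<n
    z≡k′ = toℕ-injective (trans z≡k (sym (toℕ-fromℕ< k<n)))
    into-k : ∀ {x} → Path k x z ⊎ (Path k x (fromℕ< k<n) × Path k (fromℕ< k<n) z) → Path k x (fromℕ< k<n)
    into-k (inj₁ p′) = subst (Path k _) z≡k′ p′
    into-k (inj₂ (p₁ , _)) = p₁
    out-of-k : ∀ {y} → Path k z y ⊎ (Path k z (fromℕ< k<n) × Path k (fromℕ< k<n) y) → Path k (fromℕ< k<n) y
    out-of-k (inj₁ q′) = subst (λ w → Path k w _) z≡k′ q′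
    out-of-k (inj₂ (_ , q₂)) = q₂

  path? : ∀ k → k ℕ.≤ n → Decidable₂ (Path k)
  path? zero _ x y with (x ≟ y) ⊎-dec (x ~? y)
  ... | yes e = yes (edge e)
  ... | no ¬e = no λ { (edge e) → ¬e e ; (via _ () _ _) }
  path? (suc k) k<n x y with path? k (ℕ.<⇒≤ k<n) x y | path? k (ℕ.<⇒≤ k<n) x (fromℕ< k<n)
                               | path? k (ℕ.<⇒≤ k<n) (fromℕ< k<n) y
  ... | yes p | _ | _ = yes (Path-suc p)
  ... | no _ | yes p | yes q = yes (via (fromℕ< k<n) (ℕ.≤-reflexive (cong suc (toℕ-fromℕ< k<n))) (Path-suc p) (Path-suc q))
  ... | no ¬p | yes _ | no ¬q = no λ r → [ ¬p , (λ (_ , q) → ¬q q) ] (Path-split k<n r)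
  ... | no ¬p | no ¬q | _ = no λ r → [ ¬p , (λ (q , _) → ¬q q) ] (Path-split k<n r)

  star? : Decidable₂ (Star _~_)
  star? x y = Dec.map′ Path-sound Path-complete (path? n ℕ.≤-refl x y)

module _ {R : RelStr} {S : Pred (RelStr.Carrier R) 0ℓ} where

  ChainStep : Rel (RelStr.Carrier R) _
  ChainStep x z = Comparable R x z × S z

  Star⇔Chain : ∀ {x y} → Star ChainStep x y ⇔ Chain R S x y
  Star⇔Chain = mk⇔ star⇒chain chain⇒star
    where
    star⇒chain : ∀ {x y} → Star ChainStep x y → Chain R S x y
    star⇒chain ε = done
    star⇒chain ((c , s) ◅ p) = step c s (star⇒chain p)
    chain⇒star : ∀ {x y} → Chain R S x y → Star ChainStep x y
    chain⇒star done = ε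
    chain⇒star (step c s p) = (c , s) ◅ chain⇒star p

module _ (P : FinPoset) where
  open FinPoset P

  comparable? : Decidable₂ (Comparable (asRel P))
  comparable? x y = (x ≤? y) ⊎-dec (y ≤? x)

  connected? : ∀ {S} → U.Decidable S → Dec (Connected (asRel P) S)
  connected? {S} S? = any? S? ×-dec all? λ x → all? λ y → S? x →-dec S? y →-dec chain? x y
    where
    open Reachability {_~_ = ChainStep {asRel P} {S}} (λ x z → comparable? x z ×-dec S? z)
    chain? : Decidable₂ (Chain (asRel P) S)
    chain? x y = Dec.map Star⇔Chain (star? x y)

  isMin? : U.Decidable (IsMin (asRel P))
  isMin? x = all? λ y → (y ≤? x) →-dec (x ≟ y)

  isMax? : U.Decidable (IsMax (asRel P))
  isMax? x = all? λ y → (x ≤? y) →-dec (x ≟ y)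

  Δ? : ∀ {A M} → U.Decidable A → U.Decidable M → U.Decidable (_Δ_ (asRel P) A M)
  Δ? A? M? x = (A? x ×-dec ¬? (M? x)) ⊎-dec (¬? (A? x) ×-dec M? x)

  antichain? : U.Decidable (Antichain (asRel P))
  antichain? B = all? λ x → all? λ y → T? (B x) →-dec T? (B y) →-dec (x ≤? y) →-dec (x ≟ y)

  biconnectedXY? : ∀ X Y → U.Decidable (BiconnectedXY {asRel P} X Y)
  biconnectedXY? X Y B =
    (antichain? B ×-dec connected? (Δ? (T? ∘ B) isMin?) ×-dec connected? (Δ? (T? ∘ B) isMax?)) ×-dec
    (antichain? B ×-dec all? (λ x → agreement? (T? (X x)) (isMax? x)) ×-dec all? (λ x → agreement? (T? (Y x)) (isMin? x)))
    where
    agreement? : ∀ {x C M} → Dec C → Dec M → Dec (Agreement (T (B x)) C M)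
    agreement? {x} C? M? = ((T? (B x) ×-dec M?) →-dec C?) ×-dec (C? →-dec (T? (B x) ×-dec M?))

-- Finite posets

dual : FinPoset → FinPoset
dual P = record
  { size = size ; _≤_ = flip _≤_ ; isPartialOrder = Flip.isPartialOrder isPartialOrder ; _≤?_ = flip _≤?_ }
  where open FinPoset P

module Order (P : FinPoset) where
  open FinPoset P public
  open IsPartialOrder isPartialOrder public using (antisym) renaming (refl to ≤-refl; trans to ≤-trans)

  infix 4 _⊏_ _⊏?_
  _⊏_ : Rel (Fin size) _
  _⊏_ = _<_ P

  _⊏?_ : Decidable₂ _⊏_
  _⊏?_ = _<?_ P

  ⊏-irrefl : ∀ {x} → ¬ x ⊏ x
  ⊏-irrefl = ToStrict.<-irrefl _≡_ _≤_ refl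

  ⊏-asym : ∀ {x y} → x ⊏ y → ¬ y ⊏ x
  ⊏-asym = ToStrict.<-asym _≡_ _≤_ antisym

  ≤-⊏-trans : ∀ {x y z} → x ≤ y → y ⊏ z → x ⊏ z
  ≤-⊏-trans = ToStrict.≤-<-trans _≡_ _≤_ ≤-trans antisym (λ { refl x≤y → x≤y })

  nothing-below⇒IsMin : ∀ {x} → (∀ y → ¬ y ⊏ x) → IsMin (asRel P) x
  nothing-below⇒IsMin {x} ∄y y y≤x with x ≟ y
  ... | yes x≡y = x≡y
  ... | no x≢y = contradiction (y≤x , ≢-sym x≢y) (∄y y)

  ¬IsMin⇒∃⊏ : ∀ {x} → ¬ IsMin (asRel P) x → ∃ λ y → y ⊏ x
  ¬IsMin⇒∃⊏ {x} ¬min with any? (λ y → y ⊏? x)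
  ... | yes y⊏x = y⊏x
  ... | no ∄y = contradiction (nothing-below⇒IsMin λ y y⊏x → ∄y (y , y⊏x)) ¬min

  minimal-below : ∀ x → ∃ λ m → m ≤ x × IsMin (asRel P) m
  minimal-below x = go x (po-wellFounded isPartialOrder x)
    where
    go : ∀ x → Acc _⊏_ x → ∃ λ m → m ≤ x × IsMin (asRel P) m
    go x (acc below) with any? (λ y → y ⊏? x)
    ... | yes (y , y⊏x) = let m , m≤y , min = go y (below y⊏x) in m , ≤-trans m≤y (proj₁ y⊏x) , min
    ... | no ∄y = x , ≤-refl , nothing-below⇒IsMin λ y y⊏x → ∄y (y , y⊏x)

¬IsMax⇒∃⊐ : (P : FinPoset) → ∀ {x} → ¬ IsMax (asRel P) x → ∃ λ y → _<_ P x y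
¬IsMax⇒∃⊐ P ¬max = let y , x≤y , y≢x = Order.¬IsMin⇒∃⊏ (dual P) ¬max in y , x≤y , ≢-sym y≢x

-- Deleting e

module Deletion (P : FinPoset) (e : Fin (FinPoset.size P)) (e-nonmin : ¬ IsMin (asRel P) e) where
  open Order P

  Q′-≡ : ∀ {a b : RelStr.Carrier (Q′ P e)} → proj₁ a ≡ proj₁ b → a ≡ b
  Q′-≡ {x , p} {.x , q} refl = cong (x ,_) (T-irrelevant p q)

  IsMin-Q′ : ∀ a → IsMin (Q′ P e) a ⇔ IsMin (asRel P) (proj₁ a)
  IsMin-Q′ (x , p) = mk⇔ min⁻ (λ min (y , _) y≤x → Q′-≡ (min y y≤x))
    where
    min⁻ : IsMin (Q′ P e) (x , p) → IsMin (asRel P) x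
    min⁻ min y y≤x with y ≟ e
    ... | no y≢e = cong proj₁ (min (y , not-does⁺ (y ≟ e) y≢e) y≤x)
    ... | yes refl =
      let d , d⊏e = ¬IsMin⇒∃⊏ e-nonmin
          x≡d = cong proj₁ (min (d , not-does⁺ (d ≟ e) (proj₂ d⊏e)) (≤-trans (proj₁ d⊏e) y≤x))
      in contradiction (≤-⊏-trans (subst (e ≤_) x≡d y≤x) d⊏e) ⊏-irrefl

  module _ (B : Fin size → Bool) (e∉B : ¬ T (B e)) where
    S : Fin size → Set
    S = _Δ_ (asRel P) (T ∘ B) (IsMin (asRel P))

    S′ : RelStr.Carrier (Q′ P e) → Set
    S′ = _Δ_ (Q′ P e) (T ∘ toQ′ P e B) (IsMin (Q′ P e))

    connected-deletion : Connected (Q′ P e) S′ ⇔ Connected (asRel P) S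
    connected-deletion = mk⇔
      (Connected-image proj₁ into onto (λ _ _ c → inj₁ c))
      (Connected-preimage proj₁ into onto lift-step (λ _ _ eq → subst (Chain (Q′ P e) S′ _) (Q′-≡ eq) done))
      where
      S′⇔S : ∀ a → S′ a ⇔ S (proj₁ a)
      S′⇔S a = Δ-⇔ (⇔-id _) (IsMin-Q′ a)
      into : ∀ {a} → S′ a → S (proj₁ a)
      into {a} = to (S′⇔S a)
      onto : ∀ {y} → S y → ∃ λ a → S′ a × proj₁ a ≡ y
      onto {y} s with y ≟ e
      ... | yes refl = contradiction s [ (λ (e∈B , _) → e∉B e∈B) , (λ (_ , min) → e-nonmin min) ]
      ... | no y≢e = let a = y , not-does⁺ (y ≟ e) y≢e in a , from (S′⇔S a) s , refl
      lift-step : ∀ {a y} → S′ a → Comparable (asRel P) (proj₁ a) y → S y →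
                  ∃ λ b → S′ b × proj₁ b ≡ y × Chain (Q′ P e) S′ a b
      lift-step _ c s with onto s
      ... | b , s′ , refl = b , s′ , refl , step c s′ done

module _ (P : FinPoset) (e : Fin (FinPoset.size P))
         (e-nonmin : ¬ IsMin (asRel P) e) (e-nonmax : ¬ IsMax (asRel P) e) where
  open Order P
  private
    module Min = Deletion P e e-nonmin
    module Max = Deletion (dual P) e e-nonmax

  biconnectedXY-deletion : ∀ {X Y B} → ¬ T (X e) → ¬ T (Y e) → ¬ T (B e) →
    BiconnectedXY {Q′ P e} (toQ′ P e X) (toQ′ P e Y) (toQ′ P e B) ⇔ BiconnectedXY {asRel P} X Y B
  biconnectedXY-deletion {X} {Y} {B} e∉X e∉Y e∉B = mk⇔
    (λ ((anti′ , cmin′ , cmax′) , _ , xs′ , ys′) →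
      let anti = antichain⁻ anti′ in
      (anti , to min-side cmin′ , to max-side cmax′) , anti ,
      agreement⁻ {X} {IsMax (Q′ P e)} {IsMax (asRel P)} e∉X Max.IsMin-Q′ xs′ ,
      agreement⁻ {Y} {IsMin (Q′ P e)} {IsMin (asRel P)} e∉Y Min.IsMin-Q′ ys′)
    (λ ((anti , cmin , cmax) , _ , xs , ys) →
      let anti′ = antichain⁺ anti in
      (anti′ , from min-side cmin , from max-side cmax) , anti′ ,
      (λ a → Agreement-cong (⇔-id _) (⇔-id _) (⇔-sym (Max.IsMin-Q′ a)) (xs (proj₁ a))) ,
      (λ a → Agreement-cong (⇔-id _) (⇔-id _) (⇔-sym (Min.IsMin-Q′ a)) (ys (proj₁ a))))
    where
    min-side : Connected (Q′ P e) (_Δ_ (Q′ P e) (T ∘ toQ′ P e B) (IsMin (Q′ P e))) ⇔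
               Connected (asRel P) (_Δ_ (asRel P) (T ∘ B) (IsMin (asRel P)))
    min-side = Min.connected-deletion B e∉B
    max-side : Connected (Q′ P e) (_Δ_ (Q′ P e) (T ∘ toQ′ P e B) (IsMax (Q′ P e))) ⇔
               Connected (asRel P) (_Δ_ (asRel P) (T ∘ B) (IsMax (asRel P)))
    max-side = Composition.equivalence (Composition.equivalence Connected-ᵒᵖ⇔ (Max.connected-deletion B e∉B)) Connected-ᵒᵖ⇔
    ∉B⇒≢e : ∀ {x} → T (B x) → x ≢ e
    ∉B⇒≢e x∈B refl = e∉B x∈B
    antichain⁻ : Antichain (Q′ P e) (toQ′ P e B) → Antichain (asRel P) B
    antichain⁻ anti′ x y x∈B y∈B x≤y =
      cong proj₁ (anti′ (x , not-does⁺ (x ≟ e) (∉B⇒≢e x∈B)) (y , not-does⁺ (y ≟ e) (∉B⇒≢e y∈B)) x∈B y∈B x≤y)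
    antichain⁺ : Antichain (asRel P) B → Antichain (Q′ P e) (toQ′ P e B)
    antichain⁺ anti (x , _) (y , _) x∈B y∈B x≤y = Min.Q′-≡ (anti x y x∈B y∈B x≤y)
    agreement⁻ : ∀ {Z : Fin size → Bool} {M′ : RelStr.Carrier (Q′ P e) → Set} {M : Fin size → Set} → ¬ T (Z e) →
                 (∀ a → M′ a ⇔ M (proj₁ a)) →
                 (∀ a → Agreement (T (B (proj₁ a))) (T (Z (proj₁ a))) (M′ a)) → ∀ x → Agreement (T (B x)) (T (Z x)) (M x)
    agreement⁻ {Z} e∉Z M′⇔M agree x with x ≟ e
    ... | yes refl = Agreement-absent e∉Z (λ (e∈B , _) → e∉B e∈B)
    ... | no x≢e = let a = x , not-does⁺ (x ≟ e) x≢e in Agreement-cong (⇔-id _) (⇔-id _) (M′⇔M a) (agree a)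

  -- Casing on a separate decision: the proof in the pair mentions `x ≟ e`, so `with x ≟ e`
  -- would make `extend-toQ′` ill-typed.
  extend-by : (RelStr.Carrier (Q′ P e) → Bool) → ∀ x → Dec (x ≡ e) → Bool
  extend-by B′ x (yes _) = false
  extend-by B′ x (no x≢e) = B′ (x , not-does⁺ (x ≟ e) x≢e)

  extend : (RelStr.Carrier (Q′ P e) → Bool) → Fin size → Bool
  extend B′ x = extend-by B′ x (x ≟ e)

  extend-e : ∀ B′ → extend B′ e ≡ false
  extend-e B′ with e ≟ e
  ... | yes _ = refl
  ... | no e≢e = contradiction refl e≢e

  extend-toQ′ : ∀ B′ a → extend B′ (proj₁ a) ≡ B′ a
  extend-toQ′ B′ (x , p) = by-cases (x ≟ e)
    where
    by-cases : ∀ d → extend-by B′ x d ≡ B′ (x , p)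
    by-cases (yes x≡e) = contradiction x≡e (not-does⁻ (x ≟ e) p)
    by-cases (no _) = cong (λ q → B′ (x , q)) (T-irrelevant _ _)

  toQ′-extend : ∀ {B} → B e ≡ false → ∀ x → extend (toQ′ P e B) x ≡ B x
  toQ′-extend Be≡false x with x ≟ e
  ... | yes refl = sym Be≡false
  ... | no _ = refl

  extend-cong : ∀ {B′ B″} → (∀ a → B′ a ≡ B″ a) → ∀ x → extend B′ x ≡ extend B″ x
  extend-cong B′≗B″ x with x ≟ e
  ... | yes _ = refl
  ... | no _ = B′≗B″ _

  deletion-inverse : ∀ {X Y} → ¬ T (X e) → ¬ T (Y e) →
    Inverse (Subsets (Fin size) (Pinned (BiconnectedXY {asRel P} X Y) e false))
            (BiconnSetoid (Q′ P e) (toQ′ P e X) (toQ′ P e Y))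
  deletion-inverse {X} {Y} e∉X e∉Y = mkSetoidInverse
    (λ (B , Be≡false , bxy) → toQ′ P e B , from (transfer Be≡false) bxy)
    (λ (B′ , bxy′) → extend B′ , extend-e B′ ,
       to (transfer (extend-e B′)) (BiconnectedXY-resp (toQ′ P e X) (toQ′ P e Y) (λ a → sym (extend-toQ′ B′ a)) bxy′))
    (λ B≗ a → B≗ (proj₁ a))
    extend-cong
    (λ (B′ , _) → extend-toQ′ B′)
    (λ (_ , Be≡false , _) → toQ′-extend Be≡false)
    where
    transfer : ∀ {B} → B e ≡ false →
               BiconnectedXY {Q′ P e} (toQ′ P e X) (toQ′ P e Y) (toQ′ P e B) ⇔ BiconnectedXY {asRel P} X Y B
    transfer Be≡false = biconnectedXY-deletion e∉X e∉Y (λ e∈B → subst T Be≡false e∈B)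

-- Collapsing U and D

module Collapsing (P : FinPoset) (e : Fin (FinPoset.size P)) where
  open Order P

  infix 4 _∥_
  _∥_ : Fin size → Fin size → Set
  x ∥ y = ¬ Comparable (asRel P) x y

  data Position (x : Fin size) : Set where
    at-e : x ≡ e → Position x
    below : x ⊏ e → Position x
    above : e ⊏ x → Position x
    beside : x ∥ e → Position x

  position : ∀ x → Position x
  position x with x ≟ e | e ≤? x | x ≤? e
  ... | yes x≡e | _ | _ = at-e x≡e
  ... | no x≢e | yes e≤x | _ = above (e≤x , ≢-sym x≢e)
  ... | no x≢e | no _ | yes x≤e = below (x≤e , x≢e)
  ... | no _ | no e≰x | no x≰e = beside λ { (inj₁ x≤e) → x≰e x≤e ; (inj₂ e≤x) → e≰x e≤x }

  AvoidsDU : (Fin size → Bool) → Set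
  AvoidsDU B = ∀ {x} → x ⊏ e ⊎ e ⊏ x → ¬ T (B x)

  ParallelTo-e : (Fin size → Bool) → Set
  ParallelTo-e Z = ∀ {x} → T (Z x) → e ∥ x

  data ClassView {C : Set} (low high : C) (mid : (x : Fin size) → .(x ∥ e) → C) : C → Set where
    low-view : ClassView low high mid low
    high-view : ClassView low high mid high
    mid-view : ∀ x .(p : x ∥ e) → ClassView low high mid (mid x p)

  -- Q′/U/D described through its classes: `low` is D, `high` is U and `mid x` is {x} for x ∥ e.
  -- Unlike Q′/U/D itself this description is closed under order duality (IsCollapse-dual), which
  -- turns every statement about minimal elements into one about maximal elements.
  record IsCollapse (K : RelStr) : Set₁ where
    field
      low high : RelStr.Carrier K
      mid : (x : Fin size) → .(x ∥ e) → RelStr.Carrier K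
      view : ∀ c → ClassView low high mid c
      _∈_ : Fin size → RelStr.Carrier K → Set
      ∈-low : ∀ {x} → x ∈ low ⇔ x ⊏ e
      ∈-high : ∀ {x} → x ∈ high ⇔ e ⊏ x
      ∈-mid : ∀ {x w} .{p} → x ∈ mid w p ⇔ x ≡ w
      ≤-members : ∀ {c d} → RelStr._≤_ K c d ⇔ (∃₂ λ x y → x ∈ c × y ∈ d × x ≤ y)
      lift : (Fin size → Bool) → RelStr.Carrier K → Bool
      lift-low : ∀ B → lift B low ≡ false
      lift-high : ∀ B → lift B high ≡ false
      lift-mid : ∀ B x .p → lift B (mid x p) ≡ B x

open Collapsing using (IsCollapse; ClassView; low-view; high-view; mid-view)

IsCollapse-dual : ∀ {P e K} → IsCollapse P e K → IsCollapse (dual P) e (K ᵒᵖ)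
IsCollapse-dual {P} {e} {K} κ = record
  { low = high
  ; high = low
  ; mid = λ x p → mid x (p ∘ swap)
  ; view = λ c → swap-view (view c)
  ; _∈_ = _∈_
  ; ∈-low = mk⇔ (λ m → let e≤x , e≢x = to ∈-high m in e≤x , ≢-sym e≢x)
                (λ (e≤x , x≢e) → from ∈-high (e≤x , ≢-sym x≢e))
  ; ∈-high = mk⇔ (λ m → let x≤e , x≢e = to ∈-low m in x≤e , ≢-sym x≢e)
                 (λ (x≤e , e≢x) → from ∈-low (x≤e , ≢-sym e≢x))
  ; ∈-mid = ∈-mid
  ; ≤-members = mk⇔ (λ c≥d → let y , x , y∈d , x∈c , y≤x = to ≤-members c≥d in x , y , x∈c , y∈d , y≤x)
                    (λ (x , y , x∈c , y∈d , y≤x) → from ≤-members (y , x , y∈d , x∈c , y≤x))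
  ; lift = lift
  ; lift-low = lift-high
  ; lift-high = lift-low
  ; lift-mid = λ B x p → lift-mid B x (p ∘ swap)
  }
  where
  open IsCollapse κ
  swap-view : ∀ {c} → ClassView P e low high mid c → ClassView (dual P) e high low (λ x p → mid x (p ∘ swap)) c
  swap-view low-view = high-view
  swap-view high-view = low-view
  swap-view (mid-view x p) = mid-view x (p ∘ swap)

module MinimalSide {P : FinPoset} {e : Fin (FinPoset.size P)} {K : RelStr} (κ : IsCollapse P e K)
               (e-nonmin : ¬ IsMin (asRel P) e) (e-nonmax : ¬ IsMax (asRel P) e) where
  open Order P
  open Collapsing P e using (_∥_; AvoidsDU; Position; at-e; below; above; beside; position)
  open IsCollapse κ
  open RelStr K using () renaming (Carrier to C)

  class : Fin size → C
  class x with position x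
  ... | at-e _ = low
  ... | below _ = low
  ... | above _ = high
  ... | beside p = mid x p

  class-e : class e ≡ low
  class-e with position e
  ... | at-e _ = refl
  ... | below e⊏e = contradiction e⊏e ⊏-irrefl
  ... | above e⊏e = contradiction e⊏e ⊏-irrefl
  ... | beside e∥e = contradiction (inj₁ ≤-refl) e∥e

  class-below : ∀ {x} → x ⊏ e → class x ≡ low
  class-below {x} x⊏e with position x
  ... | at-e refl = contradiction x⊏e ⊏-irrefl
  ... | below _ = refl
  ... | above e⊏x = contradiction e⊏x (⊏-asym x⊏e)
  ... | beside x∥e = contradiction (inj₁ (proj₁ x⊏e)) x∥e

  class-above : ∀ {x} → e ⊏ x → class x ≡ high
  class-above {x} e⊏x with position x
  ... | at-e refl = contradiction e⊏x ⊏-irrefl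
  ... | below x⊏e = contradiction e⊏x (⊏-asym x⊏e)
  ... | above _ = refl
  ... | beside x∥e = contradiction (inj₂ (proj₁ e⊏x)) x∥e

  class-beside : ∀ {x} .(x∥e : x ∥ e) → class x ≡ mid x x∥e
  class-beside {x} x∥e with position x
  ... | at-e refl = Irrelevant.⊥-elim (x∥e (inj₁ ≤-refl))
  ... | below x⊏e = Irrelevant.⊥-elim (x∥e (inj₁ (proj₁ x⊏e)))
  ... | above e⊏x = Irrelevant.⊥-elim (x∥e (inj₂ (proj₁ e⊏x)))
  ... | beside _ = refl

  ∈-class : ∀ {x} → x ≢ e → x ∈ class x
  ∈-class {x} x≢e with position x
  ... | at-e x≡e = contradiction x≡e x≢e
  ... | below x⊏e = from ∈-low x⊏e
  ... | above e⊏x = from ∈-high e⊏x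
  ... | beside _ = from ∈-mid refl

  class-∈ : ∀ {x c} → x ∈ c → class x ≡ c
  class-∈ {x} {c} x∈c with view c
  ... | low-view = class-below (to ∈-low x∈c)
  ... | high-view = class-above (to ∈-high x∈c)
  ... | mid-view w w∥e with refl ← to ∈-mid x∈c = class-beside w∥e

  ∈-unique : ∀ {x c d} → x ∈ c → x ∈ d → c ≡ d
  ∈-unique x∈c x∈d = trans (sym (class-∈ x∈c)) (class-∈ x∈d)

  mid-injective : ∀ {x y} .{p q} → mid x p ≡ mid y q → x ≡ y
  mid-injective {x} eq = to ∈-mid (subst (x ∈_) eq (from ∈-mid refl))

  low≢mid : ∀ {x} .{p} → low ≢ mid x p
  low≢mid {x} {p} eq = Irrelevant.⊥-elim (p (inj₁ (proj₁ (to ∈-low (subst (x ∈_) (sym eq) (from ∈-mid refl))))))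

  comparable-members : ∀ {c d x y} → x ∈ c → y ∈ d → Comparable (asRel P) x y → Comparable K c d
  comparable-members x∈c y∈d (inj₁ x≤y) = inj₁ (from ≤-members (_ , _ , x∈c , y∈d , x≤y))
  comparable-members x∈c y∈d (inj₂ y≤x) = inj₂ (from ≤-members (_ , _ , y∈d , x∈c , y≤x))

  members-comparable : ∀ {c d} → Comparable K c d → ∃₂ λ x y → x ∈ c × y ∈ d × Comparable (asRel P) x y
  members-comparable (inj₁ c≤d) = let x , y , x∈c , y∈d , x≤y = to ≤-members c≤d in x , y , x∈c , y∈d , inj₁ x≤y
  members-comparable (inj₂ d≤c) = let y , x , y∈d , x∈c , y≤x = to ≤-members d≤c in x , y , x∈c , y∈d , inj₂ y≤x

  mid-comparable : ∀ {x y} .{p q} → Comparable K (mid x p) (mid y q) → Comparable (asRel P) x y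
  mid-comparable c with members-comparable c
  ... | _ , _ , x′∈ , y′∈ , c′ with refl ← to ∈-mid x′∈ | refl ← to ∈-mid y′∈ = c′

  low-comparable-mid : ∀ {y} .{q} → Comparable K low (mid y q) → ∃ λ d → d ⊏ e × d ≤ y
  low-comparable-mid {q = q} c with members-comparable c
  ... | d , _ , d∈low , y′∈ , c′ with refl ← to ∈-mid y′∈ | c′
  ... | inj₁ d≤y = d , to ∈-low d∈low , d≤y
  ... | inj₂ y≤d = Irrelevant.⊥-elim (q (inj₁ (proj₁ (≤-⊏-trans y≤d (to ∈-low d∈low)))))

  IsMin-low : IsMin K low
  IsMin-low c c≤low =
    let x , y , x∈c , y∈low , x≤y = to ≤-members c≤low
    in ∈-unique (from ∈-low (≤-⊏-trans x≤y (to ∈-low y∈low))) x∈c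

  ¬IsMin-high : ¬ IsMin K high
  ¬IsMin-high min =
    let d , d⊏e = ¬IsMin⇒∃⊏ e-nonmin
        u , e⊏u = ¬IsMax⇒∃⊐ P e-nonmax
        high≡low = min low (from ≤-members (d , u , from ∈-low d⊏e , from ∈-high e⊏u , ≤-trans (proj₁ d⊏e) (proj₁ e⊏u)))
    in ⊏-asym e⊏u (to ∈-low (subst (u ∈_) high≡low (from ∈-high e⊏u)))

  IsMin-mid : ∀ {x} .(x∥e : x ∥ e) → IsMin K (mid x x∥e) ⇔ IsMin (asRel P) x
  IsMin-mid {x} x∥e = mk⇔ min⁻ min⁺
    where
    min⁻ : IsMin K (mid x x∥e) → IsMin (asRel P) x
    min⁻ min y y≤x with y ≟ e
    ... | yes refl = Irrelevant.⊥-elim (x∥e (inj₂ y≤x))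
    ... | no y≢e =
      let mid≡class = min (class y) (from ≤-members (y , x , ∈-class y≢e , from ∈-mid refl , y≤x))
      in sym (to ∈-mid (subst (y ∈_) (sym mid≡class) (∈-class y≢e)))
    min⁺ : IsMin (asRel P) x → IsMin K (mid x x∥e)
    min⁺ min c c≤mid with to ≤-members c≤mid
    ... | y , x′ , y∈c , x′∈mid , y≤x′ with refl ← to ∈-mid x′∈mid =
      ∈-unique (from ∈-mid refl) (subst (_∈ c) (sym (min y y≤x′)) y∈c)

  module _ (B : Fin size → Bool) (e∈B : T (B e)) (B-avoids : AvoidsDU B) where
    S : Fin size → Set
    S = _Δ_ (asRel P) (T ∘ B) (IsMin (asRel P))

    S′ : C → Set
    S′ = _Δ_ K (T ∘ lift B) (IsMin K)

    S-e : S e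
    S-e = inj₁ (e∈B , e-nonmin)

    S-minimal : ∀ {x} → x ⊏ e → IsMin (asRel P) x → S x
    S-minimal x⊏e min = inj₂ (B-avoids (inj₁ x⊏e) , min)

    ¬S-above : ∀ {x} → e ⊏ x → ¬ S x
    ¬S-above e⊏x (inj₁ (x∈B , _)) = B-avoids (inj₂ e⊏x) x∈B
    ¬S-above e⊏x (inj₂ (_ , min)) = proj₂ e⊏x (sym (min e (proj₁ e⊏x)))

    S′-low : S′ low
    S′-low = inj₂ (to (T-⇔ (lift-low B)) , IsMin-low)

    ¬S′-high : ¬ S′ high
    ¬S′-high (inj₁ (t , _)) = to (T-⇔ (lift-high B)) t
    ¬S′-high (inj₂ (_ , min)) = ¬IsMin-high min

    S′-mid : ∀ {x} .(x∥e : x ∥ e) → S′ (mid x x∥e) ⇔ S x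
    S′-mid {x} x∥e = Δ-⇔ (T-⇔ (lift-mid B x x∥e)) (IsMin-mid x∥e)

    -- A minimal element below d lies in S and is comparable with both e and y.
    e⇝above : ∀ {d y} → d ⊏ e → d ≤ y → S y → Chain (asRel P) S e y
    e⇝above d⊏e d≤y sy =
      let m , m≤d , min = minimal-below _
          m⊏e = ≤-⊏-trans m≤d d⊏e
      in step (inj₂ (proj₁ m⊏e)) (S-minimal m⊏e min) (step (inj₁ (≤-trans m≤d d≤y)) sy done)

    class-into : ∀ {x} → S x → S′ (class x)
    class-into {x} sx with position x
    ... | at-e _ = S′-low
    ... | below _ = S′-low
    ... | above e⊏x = contradiction sx (¬S-above e⊏x)
    ... | beside x∥e = from (S′-mid x∥e) sx

    class-onto : ∀ {c} → S′ c → ∃ λ x → S x × class x ≡ c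
    class-onto {c} s′ with view c
    ... | low-view = e , S-e , class-e
    ... | high-view = contradiction s′ ¬S′-high
    ... | mid-view x x∥e = x , to (S′-mid x∥e) s′ , class-beside x∥e

    class-comparable : ∀ {x y} → S x → S y → Comparable (asRel P) x y →
                       Comparable K (class x) (class y) ⊎ class x ≡ class y
    class-comparable {x} {y} sx sy c with position x | position y
    ... | above e⊏x | _ = contradiction sx (¬S-above e⊏x)
    ... | _ | above e⊏y = contradiction sy (¬S-above e⊏y)
    ... | at-e refl | beside y∥e = contradiction (swap c) y∥e
    ... | beside x∥e | at-e refl = contradiction c x∥e
    ... | at-e _ | at-e _ = inj₂ refl
    ... | at-e _ | below _ = inj₂ refl
    ... | below _ | at-e _ = inj₂ refl
    ... | below _ | below _ = inj₂ refl
    ... | below x⊏e | beside _ = inj₁ (comparable-members (from ∈-low x⊏e) (from ∈-mid refl) c)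
    ... | beside _ | below y⊏e = inj₁ (comparable-members (from ∈-mid refl) (from ∈-low y⊏e) c)
    ... | beside _ | beside _ = inj₁ (comparable-members (from ∈-mid refl) (from ∈-mid refl) c)

    lift-from-low : ∀ {x c} → Chain (asRel P) S x e → Comparable K low c → S′ c →
                    ∃ λ y → S y × class y ≡ c × Chain (asRel P) S x y
    lift-from-low {c = c} x⇝e cmp s′ with view c
    ... | low-view = e , S-e , class-e , x⇝e
    ... | high-view = contradiction s′ ¬S′-high
    ... | mid-view y y∥e =
      let sy = to (S′-mid y∥e) s′
          d , d⊏e , d≤y = low-comparable-mid cmp
      in y , sy , class-beside y∥e , x⇝e ++ᶜ e⇝above d⊏e d≤y sy

    lift-from-mid : ∀ {x c} .{x∥e : x ∥ e} → S x → Comparable K (mid x x∥e) c → S′ c →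
                    ∃ λ y → S y × class y ≡ c × Chain (asRel P) S x y
    lift-from-mid {c = c} sx cmp s′ with view c
    ... | low-view =
      let d , d⊏e , d≤x = low-comparable-mid (swap cmp)
      in e , S-e , class-e , Chain-reverse S-e (e⇝above d⊏e d≤x sx)
    ... | high-view = contradiction s′ ¬S′-high
    ... | mid-view y y∥e =
      let sy = to (S′-mid y∥e) s′
      in y , sy , class-beside y∥e , step (mid-comparable cmp) sy done

    class-lift-step : ∀ {x c} → S x → Comparable K (class x) c → S′ c →
                      ∃ λ y → S y × class y ≡ c × Chain (asRel P) S x y
    class-lift-step {x} sx cmp s′ with position x
    ... | at-e refl = lift-from-low done cmp s′
    ... | below x⊏e = lift-from-low (step (inj₁ (proj₁ x⊏e)) S-e done) cmp s′
    ... | above e⊏x = contradiction sx (¬S-above e⊏x)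
    ... | beside _ = lift-from-mid sx cmp s′

    class-fibre : ∀ {x y} → S x → S y → class x ≡ class y → Chain (asRel P) S x y
    class-fibre {x} {y} sx sy eq with position x | position y
    ... | above e⊏x | _ = contradiction sx (¬S-above e⊏x)
    ... | _ | above e⊏y = contradiction sy (¬S-above e⊏y)
    ... | beside _ | beside _ with refl ← mid-injective eq = done
    ... | beside _ | at-e _ = contradiction (sym eq) low≢mid
    ... | beside _ | below _ = contradiction (sym eq) low≢mid
    ... | at-e _ | beside _ = contradiction eq low≢mid
    ... | below _ | beside _ = contradiction eq low≢mid
    ... | at-e refl | at-e refl = done
    ... | at-e refl | below y⊏e = step (inj₂ (proj₁ y⊏e)) sy done
    ... | below x⊏e | at-e refl = step (inj₁ (proj₁ x⊏e)) S-e done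
    ... | below x⊏e | below y⊏e = step (inj₁ (proj₁ x⊏e)) S-e (step (inj₂ (proj₁ y⊏e)) sy done)

    connected-collapse : Connected K S′ ⇔ Connected (asRel P) S
    connected-collapse = mk⇔
      (Connected-preimage class class-into class-onto class-lift-step class-fibre)
      (Connected-image class class-into class-onto class-comparable)

module _ {P : FinPoset} {e : Fin (FinPoset.size P)} {K : RelStr} (κ : IsCollapse P e K)
         (e-nonmin : ¬ IsMin (asRel P) e) (e-nonmax : ¬ IsMax (asRel P) e) where
  open Order P
  open Collapsing P e using (_∥_; AvoidsDU; ParallelTo-e; Position; at-e; below; above; beside; position)
  open IsCollapse κ
  open RelStr K using () renaming (Carrier to C)
  private
    module Min = MinimalSide κ e-nonmin e-nonmax
    module Max = MinimalSide (IsCollapse-dual κ) e-nonmax e-nonmin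

  antichain-avoids : ∀ {B} → T (B e) → Antichain (asRel P) B → AvoidsDU B
  antichain-avoids e∈B anti (inj₁ (x≤e , x≢e)) x∈B = x≢e (anti _ e x∈B e∈B x≤e)
  antichain-avoids e∈B anti (inj₂ (e≤x , e≢x)) x∈B = e≢x (anti e _ e∈B x∈B e≤x)

  module _ {B : Fin size → Bool} (e∈B : T (B e)) (B-avoids : AvoidsDU B) where

    ∈B-position : ∀ {x} → T (B x) → x ≡ e ⊎ x ∥ e
    ∈B-position {x} x∈B with position x
    ... | at-e x≡e = inj₁ x≡e
    ... | below x⊏e = contradiction x∈B (B-avoids (inj₁ x⊏e))
    ... | above e⊏x = contradiction x∈B (B-avoids (inj₂ e⊏x))
    ... | beside x∥e = inj₂ x∥e

    antichain-collapse : Antichain K (lift B) ⇔ Antichain (asRel P) B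
    antichain-collapse = mk⇔ anti⁻ anti⁺
      where
      anti⁻ : Antichain K (lift B) → Antichain (asRel P) B
      anti⁻ anti′ x y x∈B y∈B x≤y with ∈B-position x∈B | ∈B-position y∈B
      ... | inj₁ refl | inj₁ refl = refl
      ... | inj₁ refl | inj₂ y∥e = contradiction (inj₂ x≤y) y∥e
      ... | inj₂ x∥e | inj₁ refl = contradiction (inj₁ x≤y) x∥e
      ... | inj₂ x∥e | inj₂ y∥e = Min.mid-injective (anti′ (mid x x∥e) (mid y y∥e)
        (from (T-⇔ (lift-mid B x x∥e)) x∈B) (from (T-⇔ (lift-mid B y y∥e)) y∈B)
        (from ≤-members (x , y , from ∈-mid refl , from ∈-mid refl , x≤y)))
      anti⁺ : Antichain (asRel P) B → Antichain K (lift B)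
      anti⁺ anti c d c∈B d∈B c≤d with view c | view d
      ... | low-view | _ = contradiction c∈B (to (T-⇔ (lift-low B)))
      ... | high-view | _ = contradiction c∈B (to (T-⇔ (lift-high B)))
      ... | mid-view _ _ | low-view = contradiction d∈B (to (T-⇔ (lift-low B)))
      ... | mid-view _ _ | high-view = contradiction d∈B (to (T-⇔ (lift-high B)))
      ... | mid-view x x∥e | mid-view y y∥e
        with x′ , y′ , x′∈ , y′∈ , x′≤y′ ← to ≤-members c≤d
        with refl ← to ∈-mid x′∈ | refl ← to ∈-mid y′∈
        with refl ← anti x y (to (T-⇔ (lift-mid B x x∥e)) c∈B) (to (T-⇔ (lift-mid B y y∥e)) d∈B) x′≤y′ = refl

    private
      agreement⁻ : ∀ {Z} → ParallelTo-e Z → ∀ {M′ : C → Set} {M : Fin size → Set} → ¬ M e →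
                   (∀ {x} .(x∥e : x ∥ e) → M′ (mid x x∥e) ⇔ M x) →
                   (∀ c → Agreement (T (lift B c)) (T (lift Z c)) (M′ c)) → ∀ x → Agreement (T (B x)) (T (Z x)) (M x)
      agreement⁻ {Z} e∥Z ¬Me M-mid agree x with position x
      ... | at-e refl = Agreement-absent (λ z → e∥Z z (inj₁ ≤-refl)) (λ (_ , m) → ¬Me m)
      ... | below x⊏e = Agreement-absent (λ z → e∥Z z (inj₂ (proj₁ x⊏e))) (λ (b , _) → B-avoids (inj₁ x⊏e) b)
      ... | above e⊏x = Agreement-absent (λ z → e∥Z z (inj₁ (proj₁ e⊏x))) (λ (b , _) → B-avoids (inj₂ e⊏x) b)
      ... | beside x∥e = Agreement-cong (T-⇔ (lift-mid B x x∥e)) (T-⇔ (lift-mid Z x x∥e)) (M-mid x∥e) (agree (mid x x∥e))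

      agreement⁺ : ∀ {Z} {M′ : C → Set} {M : Fin size → Set} → (∀ {x} .(x∥e : x ∥ e) → M′ (mid x x∥e) ⇔ M x) →
                   (∀ x → Agreement (T (B x)) (T (Z x)) (M x)) → ∀ c → Agreement (T (lift B c)) (T (lift Z c)) (M′ c)
      agreement⁺ {Z} M-mid agree c with view c
      ... | low-view = Agreement-absent (to (T-⇔ (lift-low Z))) (λ (b , _) → to (T-⇔ (lift-low B)) b)
      ... | high-view = Agreement-absent (to (T-⇔ (lift-high Z))) (λ (b , _) → to (T-⇔ (lift-high B)) b)
      ... | mid-view x x∥e = Agreement-cong (⇔-sym (T-⇔ (lift-mid B x x∥e))) (⇔-sym (T-⇔ (lift-mid Z x x∥e)))
                                            (⇔-sym (M-mid x∥e)) (agree x)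

      IsMax-mid : ∀ {x} .(x∥e : x ∥ e) → IsMax K (mid x x∥e) ⇔ IsMax (asRel P) x
      IsMax-mid x∥e = Max.IsMin-mid (x∥e ∘ swap)

      min-side : Connected K (_Δ_ K (T ∘ lift B) (IsMin K)) ⇔ Connected (asRel P) (_Δ_ (asRel P) (T ∘ B) (IsMin (asRel P)))
      min-side = Min.connected-collapse B e∈B B-avoids

      max-side : Connected K (_Δ_ K (T ∘ lift B) (IsMax K)) ⇔ Connected (asRel P) (_Δ_ (asRel P) (T ∘ B) (IsMax (asRel P)))
      max-side = Composition.equivalence (⇔-sym Connected-ᵒᵖ⇔)
                   (Composition.equivalence (Max.connected-collapse B e∈B B-avoids-dual) Connected-ᵒᵖ⇔)
        where
        B-avoids-dual : Collapsing.AvoidsDU (dual P) e B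
        B-avoids-dual (inj₁ (e≤x , x≢e)) = B-avoids (inj₂ (e≤x , ≢-sym x≢e))
        B-avoids-dual (inj₂ (x≤e , e≢x)) = B-avoids (inj₁ (x≤e , ≢-sym e≢x))

    biconnectedXY-collapse : ∀ {X Y} → ParallelTo-e X → ParallelTo-e Y →
      BiconnectedXY {K} (lift X) (lift Y) (lift B) ⇔ BiconnectedXY {asRel P} X Y B
    biconnectedXY-collapse e∥X e∥Y = mk⇔
      (λ ((anti′ , cmin′ , cmax′) , _ , xs′ , ys′) →
        let anti = to antichain-collapse anti′ in
        (anti , to min-side cmin′ , to max-side cmax′) , anti ,
        agreement⁻ e∥X e-nonmax IsMax-mid xs′ , agreement⁻ e∥Y e-nonmin Min.IsMin-mid ys′)
      (λ ((anti , cmin , cmax) , _ , xs , ys) →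
        let anti′ = from antichain-collapse anti in
        (anti′ , from min-side cmin , from max-side cmax) , anti′ ,
        agreement⁺ IsMax-mid xs , agreement⁺ Min.IsMin-mid ys)

  unlift : (C → Bool) → Fin size → Bool
  unlift B″ x with position x
  ... | at-e _ = true
  ... | below _ = false
  ... | above _ = false
  ... | beside x∥e = B″ (mid x x∥e)

  unlift-e : ∀ B″ → T (unlift B″ e)
  unlift-e B″ with position e
  ... | at-e _ = _
  ... | below e⊏e = contradiction e⊏e ⊏-irrefl
  ... | above e⊏e = contradiction e⊏e ⊏-irrefl
  ... | beside e∥e = contradiction (inj₁ ≤-refl) e∥e

  unlift-avoids : ∀ B″ → AvoidsDU (unlift B″)
  unlift-avoids B″ {x} x⋚e with position x
  ... | at-e refl = λ _ → [ ⊏-irrefl , ⊏-irrefl ] x⋚e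
  ... | below _ = λ ()
  ... | above _ = λ ()
  ... | beside x∥e = λ _ → x∥e ([ inj₁ ∘ proj₁ , inj₂ ∘ proj₁ ] x⋚e)

  unlift-mid : ∀ B″ {x} .(x∥e : x ∥ e) → unlift B″ x ≡ B″ (mid x x∥e)
  unlift-mid B″ {x} x∥e with position x
  ... | at-e refl = Irrelevant.⊥-elim (x∥e (inj₁ ≤-refl))
  ... | below x⊏e = Irrelevant.⊥-elim (x∥e (inj₁ (proj₁ x⊏e)))
  ... | above e⊏x = Irrelevant.⊥-elim (x∥e (inj₂ (proj₁ e⊏x)))
  ... | beside _ = refl

  lift-unlift : ∀ {X Y B″} → BiconnectedXY {K} (lift X) (lift Y) B″ → ∀ c → lift (unlift B″) c ≡ B″ c
  lift-unlift {X} {Y} {B″} (_ , _ , xs , ys) c with view c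
  ... | low-view = trans (lift-low _) (sym (¬T⇒≡false λ t → to (T-⇔ (lift-low Y)) (proj₁ (ys low) (t , Min.IsMin-low))))
  ... | high-view = trans (lift-high _) (sym (¬T⇒≡false λ t → to (T-⇔ (lift-high X)) (proj₁ (xs high) (t , Max.IsMin-low))))
  ... | mid-view x x∥e = trans (lift-mid _ x x∥e) (unlift-mid B″ x∥e)

  unlift-lift : ∀ {B} → T (B e) → AvoidsDU B → ∀ x → unlift (lift B) x ≡ B x
  unlift-lift {B} e∈B B-avoids x with position x
  ... | at-e refl = sym (to T-≡ e∈B)
  ... | below x⊏e = sym (¬T⇒≡false (B-avoids (inj₁ x⊏e)))
  ... | above e⊏x = sym (¬T⇒≡false (B-avoids (inj₂ e⊏x)))
  ... | beside x∥e = lift-mid B x x∥e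

  lift-cong : ∀ {B B′} → (∀ x → B x ≡ B′ x) → ∀ c → lift B c ≡ lift B′ c
  lift-cong {B} {B′} B≗B′ c with view c
  ... | low-view = trans (lift-low B) (sym (lift-low B′))
  ... | high-view = trans (lift-high B) (sym (lift-high B′))
  ... | mid-view x x∥e = trans (lift-mid B x x∥e) (trans (B≗B′ x) (sym (lift-mid B′ x x∥e)))

  unlift-cong : ∀ {B″ B‴} → (∀ c → B″ c ≡ B‴ c) → ∀ x → unlift B″ x ≡ unlift B‴ x
  unlift-cong B″≗B‴ x with position x
  ... | at-e _ = refl
  ... | below _ = refl
  ... | above _ = refl
  ... | beside _ = B″≗B‴ _

  collapse-inverse : ∀ {X Y} → ParallelTo-e X → ParallelTo-e Y →
    Inverse (Subsets (Fin size) (Pinned (BiconnectedXY {asRel P} X Y) e true)) (BiconnSetoid K (lift X) (lift Y))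
  collapse-inverse {X} {Y} e∥X e∥Y = mkSetoidInverse
    (λ (B , Be≡true , bxy) → lift B , from (transfer B (e∈ B Be≡true) (avoids B Be≡true bxy)) bxy)
    (λ (B″ , bxy″) → unlift B″ , to T-≡ (unlift-e B″) ,
      to (transfer (unlift B″) (unlift-e B″) (unlift-avoids B″)) (BiconnectedXY-resp (lift X) (lift Y) (λ c → sym (lift-unlift bxy″ c)) bxy″))
    lift-cong
    unlift-cong
    (λ (_ , bxy″) → lift-unlift bxy″)
    (λ (B , Be≡true , bxy) → unlift-lift (e∈ B Be≡true) (avoids B Be≡true bxy))
    where
    e∈ : ∀ B → B e ≡ true → T (B e)
    e∈ B = from (T-≡ {B e})
    avoids : ∀ B → B e ≡ true → BiconnectedXY {asRel P} X Y B → AvoidsDU B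
    avoids B Be≡true ((anti , _) , _) = antichain-avoids (e∈ B Be≡true) anti
    transfer : ∀ B → T (B e) → AvoidsDU B → BiconnectedXY {K} (lift X) (lift Y) (lift B) ⇔ BiconnectedXY {asRel P} X Y B
    transfer B e∈B B-avoids = biconnectedXY-collapse e∈B B-avoids e∥X e∥Y

module _ (P : FinPoset) (e : Fin (FinPoset.size P))
         (e-nonmin : ¬ IsMin (asRel P) e) (e-nonmax : ¬ IsMax (asRel P) e) where
  open Order P
  open Collapsing P e using (_∥_)

  private
    Q′-elem : ∀ x → x ≢ e → RelStr.Carrier (Q′ P e)
    Q′-elem x x≢e = x , not-does⁺ (x ≟ e) x≢e

    QU-elem : ∀ x → x ≢ e → .(¬ e ⊏ x) → RelStr.Carrier (Q′/U P e)
    QU-elem x x≢e ¬e⊏x = elt (Q′-elem x x≢e) (not-does⁺ (e ⊏? x) ¬e⊏x)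

    ∥e⇒≢e : ∀ {x} → x ∥ e → x ≢ e
    ∥e⇒≢e x∥e refl = x∥e (inj₁ ≤-refl)

    low : RelStr.Carrier (Q′/U/D P e)
    low = blob (let d , d⊏e = ¬IsMin⇒∃⊏ e-nonmin
                in QU-elem d (proj₂ d⊏e) (⊏-asym d⊏e) , does⁺ (d ⊏? e) d⊏e)

    high : RelStr.Carrier (Q′/U/D P e)
    high = elt (blob (let u , e⊏u = ¬IsMax⇒∃⊐ P e-nonmax
                      in Q′-elem u (≢-sym (proj₂ e⊏u)) , does⁺ (e ⊏? u) e⊏u)) tt

    mid : ∀ x → .(x ∥ e) → RelStr.Carrier (Q′/U/D P e)
    mid x x∥e = elt (elt (x , recompute (T? _) (not-does⁺ (x ≟ e) (∥e⇒≢e x∥e)))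
                         (not-does⁺ (e ⊏? x) (λ e⊏x → x∥e (inj₂ (proj₁ e⊏x)))))
                    (not-does⁺ (x ⊏? e) (λ x⊏e → x∥e (inj₁ (proj₁ x⊏e))))

    _∈_ : Fin size → RelStr.Carrier (Q′/U/D P e) → Set
    x ∈ blob _ = x ⊏ e
    x ∈ elt (blob _) _ = e ⊏ x
    x ∈ elt (elt a _) _ = x ≡ proj₁ a

    ∈-nested : ∀ {c a a′} → InCls a c → InCls a′ a → proj₁ a′ ∈ c
    ∈-nested {blob _} {elt a _} a∈c refl = does⁻ (_ ⊏? e) a∈c
    ∈-nested {elt (blob _) _} refl a′∈a = does⁻ (e ⊏? _) a′∈a
    ∈-nested {elt (elt _ _) _} refl refl = refl

    nested-∈ : ∀ {x c} → x ∈ c → ∃₂ λ a a′ → InCls a c × InCls a′ a × proj₁ a′ ≡ x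
    nested-∈ {x} {blob _} x⊏e = QU-elem x (proj₂ x⊏e) (⊏-asym x⊏e) , _ , does⁺ (x ⊏? e) x⊏e , refl , refl
    nested-∈ {x} {elt (blob _) _} e⊏x = _ , Q′-elem x (≢-sym (proj₂ e⊏x)) , refl , does⁺ (e ⊏? x) e⊏x , refl
    nested-∈ {x} {elt (elt a _) _} refl = _ , a , refl , refl , refl

    -- `mid x` stores a recomputed proof of x ≢ e, equal to the one in c only up to T-irrelevant.
    view : ∀ c → ClassView P e low high mid c
    view (blob _) = low-view
    view (elt (blob _) _) = high-view
    view (elt (elt (x , x≢e) e⊀x) x⊀e) =
      subst (ClassView P e low high mid) (cong (λ p → elt (elt (x , p) e⊀x) x⊀e) (T-irrelevant _ _))
            (mid-view x λ { (inj₁ x≤e) → not-does⁻ (x ⊏? e) x⊀e (x≤e , not-does⁻ (x ≟ e) x≢e)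
                          ; (inj₂ e≤x) → not-does⁻ (e ⊏? x) e⊀x (e≤x , ≢-sym (not-does⁻ (x ≟ e) x≢e)) })

    ≤-members : ∀ {c d} → RelStr._≤_ (Q′/U/D P e) c d ⇔ (∃₂ λ x y → x ∈ c × y ∈ d × x ≤ y)
    ≤-members = mk⇔
      (λ (_ , _ , a∈c , b∈d , _ , _ , a′∈a , b′∈b , a′≤b′) → _ , _ , ∈-nested a∈c a′∈a , ∈-nested b∈d b′∈b , a′≤b′)
      (λ (x , y , x∈c , y∈d , x≤y) →
        let a , a′ , a∈c , a′∈a , a′≡x = nested-∈ x∈c
            b , b′ , b∈d , b′∈b , b′≡y = nested-∈ y∈d
        in a , b , a∈c , b∈d , a′ , b′ , a′∈a , b′∈b , subst₂ _≤_ (sym a′≡x) (sym b′≡y) x≤y)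

  Q′/U/D-isCollapse : IsCollapse P e (Q′/U/D P e)
  Q′/U/D-isCollapse = record
    { low = low ; high = high ; mid = mid ; view = view ; _∈_ = _∈_
    ; ∈-low = ⇔-id _ ; ∈-high = ⇔-id _ ; ∈-mid = ⇔-id _ ; ≤-members = ≤-members
    ; lift = toQ′/U/D P e ; lift-low = λ _ → refl ; lift-high = λ _ → refl ; lift-mid = λ _ _ _ → refl }

lemma4p9 : (P : FinPoset) → (e : Fin (FinPoset.size P)) → (X Y : Fin (FinPoset.size P) → Bool)
    → Connected (asRel P) (λ _ → ⊤)
    → ¬ IsMin (asRel P) e → ¬ IsMax (asRel P) e
    → (∀ x → T (X x) → IsMax (asRel P) x)
    → (∀ y → T (Y y) → IsMin (asRel P) y)
    → Parallel (asRel P) (λ x → x ≡ e) (λ x → T (X x))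
    → Parallel (asRel P) (λ x → x ≡ e) (λ y → T (Y y))
    → Parallel (asRel P) (λ x → T (X x)) (λ y → T (Y y))
    → Σ ℕ λ a → Σ ℕ λ b → Σ ℕ λ c →
        AlphaIs (asRel P) X Y a
      × AlphaIs (Q′ P e) (toQ′ P e X) (toQ′ P e Y) b
      × AlphaIs (Q′/U/D P e) (toQ′/U/D P e X) (toQ′/U/D P e Y) c
      × a ≡ b + c
lemma4p9 P e X Y _ e-nonmin e-nonmax _ _ e∥X e∥Y _ =
  let b , Fb = finite false
      c , Fc = finite true
  in b + c , b , c ,
     Composition.inverse (Fin-+ b c) (Composition.inverse (Fb ⊎-inverse Fc) (Symmetry.inverse (Subsets-split BXY e))) ,
     Composition.inverse Fb (deletion-inverse P e e-nonmin e-nonmax (e∉ e∥X) (e∉ e∥Y)) ,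
     Composition.inverse Fc (collapse-inverse (Q′/U/D-isCollapse P e e-nonmin e-nonmax) e-nonmin e-nonmax
                               (e∥X e _ refl) (e∥Y e _ refl)) ,
     refl
  where
  open Order P
  BXY : (Fin size → Bool) → Set
  BXY = BiconnectedXY {asRel P} X Y
  finite : ∀ v → Σ ℕ λ k → Inverse (setoid (Fin k)) (Subsets (Fin size) (Pinned BXY e v))
  finite v = subsets-finite size (Pinned BXY e v) (λ B → (B e Bool.≟ v) ×-dec biconnectedXY? P X Y B)
                            (Pinned-resp (BiconnectedXY-resp X Y))
  e∉ : ∀ {Z : Fin size → Bool} → Parallel (asRel P) (λ x → x ≡ e) (λ x → T (Z x)) → ¬ T (Z e)
  e∉ e∥Z z = e∥Z e e refl z (inj₁ ≤-refl)
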